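{- Let $\mathbf{P}=\{1,\dots,P\}$ be a finite set of partitions, $\mathbf{N}$ a finite set of nodes, $\mathbf{Z}$ a finite set of zones, where each node $n$ has a capacity $c_n\in\mathbb{Z}_{\ge 0}$ and belongs to a zone $z_n\in\mathbf{Z}$. Let $\rho_\mathbf{N},\rho_\mathbf{Z}$ be integers with $1\le\rho_\mathbf{Z}\le\rho_\mathbf{N}$, and let $s\ge 1$ be an integer. Let $G(s)$ be the directed capacitated graph described in the context. Let $\alpha=(\alpha_p)_{p\in\mathbf{P}}$ be an assignment, i.e. a choice of a subset $\alpha_p\subseteq\mathbf{N}$ for each partition $p$. Then $\alpha$ is realizable with partition size $s$ and replication and scattering factors $(\rho_\mathbf{N},\rho_\mathbf{Z})$ if and only if there exists a maximum (integer-valued) flow $f$ in $G(s)$ with total flow value $\rho_\mathbf{N}P$ such that the arcs $(\mathbf{x}_{p,z},\mathbf{n})$ carrying flow (i.e. with $f(\mathbf{x}_{p,z},\mathbf{n})=1$) are exactly those for which $n\in\alpha_p$.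
   Context: The graph $G(s)$ has vertex set consisting of a source $\mathbf{s}$, a sink $\mathbf{t}$, two vertices $\mathbf{p}^+,\mathbf{p}^-$ for every partition $p$, a vertex $\mathbf{x}_{p,z}$ for every partition $p$ and zone $z$, and a vertex $\mathbf{n}$ for every node $n$. Its arcs, with capacities, are: $(\mathbf{s},\mathbf{p}^+)$ with capacity $\rho_\mathbf{Z}$ and $(\mathbf{s},\mathbf{p}^-)$ with capacity $\rho_\mathbf{N}-\rho_\mathbf{Z}$ for every $p$; $(\mathbf{p}^+,\mathbf{x}_{p,z})$ with capacity $1$ and $(\mathbf{p}^-,\mathbf{x}_{p,z})$ with capacity $\rho_\mathbf{N}-\rho_\mathbf{Z}$ for every $p$ and $z$; $(\mathbf{x}_{p,z},\mathbf{n})$ with capacity $1$ for every $p$, every zone $z$ and every node $n$ with $z_n=z$; $(\mathbf{n},\mathbf{t})$ with capacity $\lfloor c_n/s\rfloor$ for every node $n$. A flow is an integer-valued function on arcs with $0\le f(e)\le$ capacity of $e$ and conservation at all vertices other than $\mathbf{s},\mathbf{t}$; its value is the total flow leaving $\mathbf{s}$. The assignment $\alpha$ is realizable with partition size $s$ and factors $(\rho_\mathbf{N},\rho_\mathbf{Z})$ if: for every $p$, $\alpha_p$ consists of exactly $\rho_\mathbf{N}$ distinct nodes; for every $p$, the nodes of $\alpha_p$ belong to at least $\rho_\mathbf{Z}$ distinct zones; and for every node $n$, $s\cdot\#\{p\in\mathbf{P} : n\in\alpha_p\}\le c_n$. -}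

module Defs where

open import Data.Nat using (ℕ; zero; suc; _+_; _*_; _∸_; _≤_; NonZero)
open import Data.Nat.DivMod using (_/_)
open import Data.Fin using (Fin; _≟_)
open import Data.Fin.Subset using (Subset; _∈_; ∣_∣)
open import Data.Bool using (Bool; if_then_else_)
open import Data.Vec using (tabulate)
open import Data.Nat.ListAction using (sum)
import Data.List as List
open import Data.Product using (Σ; _×_; ∃)
open import Relation.Nullary using (does)
open import Relation.Nullary.Decidable using (⌊_⌋; _×-dec_)
open import Data.Fin.Subset.Properties using (_∈?_)
open import Data.Fin.Properties using (any?)
open import Relation.Binary.PropositionalEquality using (_≡_)
open import Function.Bundles using (_⇔_)

∑ : ∀ {n} → (Fin n → ℕ) → ℕ
∑ f = sum (List.tabulate f)

module Network (P N Z : ℕ) (zone : Fin N → Fin Z) (c : Fin N → ℕ)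
               (ρN ρZ s : ℕ) .{{_ : NonZero s}} where

  -- Arcs of G(s).  The arc (x_{p,z}, n) exists only for z = z_n, so these
  -- arcs are indexed by pairs (p , n) and go from x_{p, zone n} to n.
  data Arc : Set where
    s→p⁺ : Fin P → Arc
    s→p⁻ : Fin P → Arc
    p⁺→x : Fin P → Fin Z → Arc
    p⁻→x : Fin P → Fin Z → Arc
    x→n  : Fin P → Fin N → Arc
    n→t  : Fin N → Arc

  capacity : Arc → ℕ
  capacity (s→p⁺ p)   = ρZ
  capacity (s→p⁻ p)   = ρN ∸ ρZ
  capacity (p⁺→x p z) = 1
  capacity (p⁻→x p z) = ρN ∸ ρZ
  capacity (x→n p n)  = 1
  capacity (n→t n)    = c n / s

  record IsFlow (f : Arc → ℕ) : Set where
    field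
      cap      : ∀ e → f e ≤ capacity e
      cons-p⁺  : ∀ p → f (s→p⁺ p) ≡ ∑ (λ z → f (p⁺→x p z))
      cons-p⁻  : ∀ p → f (s→p⁻ p) ≡ ∑ (λ z → f (p⁻→x p z))
      cons-x   : ∀ p z → f (p⁺→x p z) + f (p⁻→x p z)
                         ≡ ∑ (λ n → if does (zone n ≟ z) then f (x→n p n) else 0)
      cons-n   : ∀ n → ∑ (λ p → f (x→n p n)) ≡ f (n→t n)

  value : (Arc → ℕ) → ℕ
  value f = ∑ (λ p → f (s→p⁺ p) + f (s→p⁻ p))

  IsMaxFlow : (Arc → ℕ) → Set
  IsMaxFlow f = IsFlow f × (∀ g → IsFlow g → value g ≤ value f)

  Assignment : Set
  Assignment = Fin P → Subset N

  zonesOf : Subset N → Subset Z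
  zonesOf A = tabulate (λ z → ⌊ any? (λ n → (n ∈? A) ×-dec (zone n ≟ z)) ⌋)

  partitionsOn : Assignment → Fin N → Subset P
  partitionsOn α n = tabulate (λ p → ⌊ n ∈? α p ⌋)

  record Realizable (α : Assignment) : Set where
    field
      size    : ∀ p → ∣ α p ∣ ≡ ρN
      scatter : ∀ p → ρZ ≤ ∣ zonesOf (α p) ∣
      load    : ∀ n → s * ∣ partitionsOn α n ∣ ≤ c n

{-# OPTIONS --safe #-}
module Submission where

-- Read a realizable assignment as a flow: one unit on (x_{p,z}, n) for every
-- replica n ∈ α_p, fed through p⁺ into ρZ distinct zones that α_p meets and
-- through p⁻ into the remaining replicas; it saturates the source cut, whose
-- capacity is ρN·P, so it is maximum.  Conversely, a flow of value ρN·P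
-- saturates every source arc.  Conservation then gives |α_p| = ρN; the ρZ
-- units leaving p⁺ travel along unit arcs to distinct zones, each of which
-- must contain a replica of p; and conservation at n bounds the number of
-- partitions on n by ⌊c_n/s⌋.

open import Defs
open import Data.Nat using (ℕ; zero; suc; _+_; _*_; _∸_; _⊓_; _≤_; _<_; z≤n; s≤s; NonZero)
open import Data.Nat.Properties hiding (_≟_)
open import Data.Nat.DivMod using (_/_; m/n*n≤m; m*n/n≡m; /-monoˡ-≤)
open import Data.Fin using (Fin; zero; suc; _≟_)
open import Data.Fin.Subset using (Subset; _∈_; ∣_∣)
open import Data.Fin.Subset.Properties using (_∈?_)
open import Data.Fin.Properties using (any?)
open import Data.Bool using (Bool; true; false; if_then_else_)
open import Data.Bool.Properties using (T-≡; ⇔→≡)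
open import Data.Vec using ([]; _∷_; lookup)
open import Data.Vec.Properties using (lookup∘tabulate; []=⇒lookup; lookup⇒[]=)
open import Data.Product using (Σ; _×_; _,_; proj₁; proj₂; ∃)
open import Relation.Nullary using (Dec; yes; no; does)
open import Relation.Nullary.Decidable using (isYes; _×-dec_; dec-true; toWitness; fromWitness)
open import Relation.Binary.PropositionalEquality
open import Function using (_∘_; flip)
open import Function.Bundles using (_⇔_; mk⇔; Equivalence)
import Function.Properties.Equivalence as ⇔
import Algebra.Properties.CommutativeMonoid.Sum +-0-commutativeMonoid as Σℕ

∑≡sum : ∀ {n} (f : Fin n → ℕ) → ∑ f ≡ Σℕ.sum f
∑≡sum {zero}  f = refl
∑≡sum {suc n} f = cong (f zero +_) (∑≡sum (f ∘ suc))

∑-cong : ∀ {n} {f g : Fin n → ℕ} → (∀ i → f i ≡ g i) → ∑ f ≡ ∑ g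
∑-cong {zero}  f≗g = refl
∑-cong {suc n} f≗g = cong₂ _+_ (f≗g zero) (∑-cong (f≗g ∘ suc))

∑-mono-≤ : ∀ {n} {f g : Fin n → ℕ} → (∀ i → f i ≤ g i) → ∑ f ≤ ∑ g
∑-mono-≤ {zero}  f≤g = z≤n
∑-mono-≤ {suc n} f≤g = +-mono-≤ (f≤g zero) (∑-mono-≤ (f≤g ∘ suc))

∑-const : ∀ {n} k → ∑ {n} (λ _ → k) ≡ k * n
∑-const {zero}  k = sym (*-zeroʳ k)
∑-const {suc n} k = trans (cong (k +_) (∑-const {n} k)) (sym (*-suc k n))

∑-distrib-+ : ∀ {n} (f g : Fin n → ℕ) → ∑ (λ i → f i + g i) ≡ ∑ f + ∑ g
∑-distrib-+ f g = begin
  ∑ (λ i → f i + g i)         ≡⟨ ∑≡sum (λ i → f i + g i) ⟩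
  Σℕ.sum (λ i → f i + g i)    ≡⟨ Σℕ.∑-distrib-+ f g ⟩
  Σℕ.sum f + Σℕ.sum g         ≡⟨ sym (cong₂ _+_ (∑≡sum f) (∑≡sum g)) ⟩
  ∑ f + ∑ g                   ∎
  where open ≡-Reasoning

∑-comm : ∀ {m n} (g : Fin m → Fin n → ℕ) →
         ∑ (λ i → ∑ (λ j → g i j)) ≡ ∑ (λ j → ∑ (λ i → g i j))
∑-comm g = begin
  ∑ (λ i → ∑ (λ j → g i j))            ≡⟨ ∑²≡sum² g ⟩
  Σℕ.sum (λ i → Σℕ.sum (λ j → g i j))  ≡⟨ Σℕ.∑-comm g ⟩
  Σℕ.sum (λ j → Σℕ.sum (λ i → g i j))  ≡⟨ sym (∑²≡sum² (flip g)) ⟩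
  ∑ (λ j → ∑ (λ i → g i j))            ∎
  where
  open ≡-Reasoning
  ∑²≡sum² : ∀ {m n} (h : Fin m → Fin n → ℕ) →
            ∑ (λ i → ∑ (h i)) ≡ Σℕ.sum (λ i → Σℕ.sum (h i))
  ∑²≡sum² h = trans (∑≡sum (λ i → ∑ (h i))) (Σℕ.sum-cong-≗ (∑≡sum ∘ h))

∑-distrib-∸ : ∀ {n} (f g : Fin n → ℕ) → (∀ i → g i ≤ f i) →
              ∑ (λ i → f i ∸ g i) ≡ ∑ f ∸ ∑ g
∑-distrib-∸ f g g≤f = begin
  ∑ (λ i → f i ∸ g i)                  ≡⟨ sym (m+n∸n≡m _ (∑ g)) ⟩
  ∑ (λ i → f i ∸ g i) + ∑ g ∸ ∑ g      ≡⟨ cong (_∸ ∑ g) (sym (∑-distrib-+ _ g)) ⟩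
  ∑ (λ i → f i ∸ g i + g i) ∸ ∑ g      ≡⟨ cong (_∸ ∑ g) (∑-cong (m∸n+n≡m ∘ g≤f)) ⟩
  ∑ f ∸ ∑ g                            ∎
  where open ≡-Reasoning

∑-indicator : ∀ {n} (k : Fin n) (v : ℕ) → ∑ (λ i → if does (k ≟ i) then v else 0) ≡ v
∑-indicator {suc n} zero    v = trans (cong (v +_) (∑-const {n} 0)) (+-identityʳ v)
∑-indicator {suc n} (suc k) v = ∑-indicator k v

f≤∑f : ∀ {n} (f : Fin n → ℕ) i → f i ≤ ∑ f
f≤∑f f zero    = m≤m+n _ _
f≤∑f f (suc i) = ≤-trans (f≤∑f (f ∘ suc) i) (m≤n+m _ (f zero))

∑>0⇒∃>0 : ∀ {n} (f : Fin n → ℕ) → 0 < ∑ f → ∃ λ i → 0 < f i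
∑>0⇒∃>0 {suc n} f ∑f>0 with f zero in eq
... | suc _ = zero , subst (0 <_) (sym eq) (s≤s z≤n)
... | zero with ∑>0⇒∃>0 (f ∘ suc) ∑f>0
...   | i , fi>0 = suc i , fi>0

∑-tight⇒≡ : ∀ {n} {f g : Fin n → ℕ} → (∀ i → f i ≤ g i) → ∑ g ≤ ∑ f →
            ∀ i → f i ≡ g i
∑-tight⇒≡ {f = f} {g} f≤g ∑g≤∑f i = ≤-antisym (f≤g i) (m∸n≡0⇒m≤n (n≤0⇒n≡0 (begin
  g i ∸ f i               ≤⟨ f≤∑f (λ j → g j ∸ f j) i ⟩
  ∑ (λ j → g j ∸ f j)     ≡⟨ ∑-distrib-∸ g f f≤g ⟩
  ∑ g ∸ ∑ f               ≡⟨ m≤n⇒m∸n≡0 ∑g≤∑f ⟩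
  0                       ∎)))
  where open ≤-Reasoning

∑-truncate : ∀ {n} (f : Fin n → ℕ) k → k ≤ ∑ f →
             Σ (Fin n → ℕ) λ g → (∀ i → g i ≤ f i) × ∑ g ≡ k
∑-truncate {zero}  f _ z≤n = f , (λ ()) , refl
∑-truncate {suc n} f k k≤∑f
  with g , g≤f , ∑g≡k∸f₀ ← ∑-truncate (f ∘ suc) (k ∸ f zero)
                                      (m≤n+o⇒m∸n≤o k (f zero) k≤∑f)
  = (λ { zero → f zero ⊓ k ; (suc i) → g i })
  , (λ { zero → m⊓n≤m (f zero) k ; (suc i) → g≤f i })
  , trans (cong (f zero ⊓ k +_) ∑g≡k∸f₀) (m⊓n+n∸m≡n (f zero) k)

*≤⇔≤/ : ∀ m n o .{{_ : NonZero n}} → n * m ≤ o ⇔ m ≤ o / n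
*≤⇔≤/ m n o = mk⇔
  (λ n*m≤o → ≤-trans (≤-reflexive (sym (m*n/n≡m m n)))
                     (/-monoˡ-≤ n (≤-trans (≤-reflexive (*-comm m n)) n*m≤o)))
  (λ m≤o/n → ≤-trans (*-monoʳ-≤ n m≤o/n)
                     (≤-trans (≤-reflexive (*-comm n (o / n))) (m/n*n≤m o n)))

χ : Bool → ℕ
χ true  = 1
χ false = 0

χ≤1 : ∀ b → χ b ≤ 1
χ≤1 true  = ≤-refl
χ≤1 false = z≤n

χ≡1⇔ : ∀ {b} → χ b ≡ 1 ⇔ b ≡ true
χ≡1⇔ {true}  = mk⇔ (λ _ → refl) (λ _ → refl)
χ≡1⇔ {false} = mk⇔ (λ ()) (λ ())

χ>0⇒≡true : ∀ {b} → 0 < χ b → b ≡ true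
χ>0⇒≡true {true} _ = refl

χ-≤ : ∀ {b k} → (b ≡ true → 1 ≤ k) → χ b ≤ k
χ-≤ {true}  1≤k = 1≤k refl
χ-≤ {false} _   = z≤n

≤-χ : ∀ {k b} → k ≤ 1 → (0 < k → b ≡ true) → k ≤ χ b
≤-χ {zero}          _   _        = z≤n
≤-χ {suc _} {true}  k≤1 _        = k≤1
≤-χ {suc _} {false} _   k>0⇒true with () ← k>0⇒true (s≤s z≤n)

≤1⇒≡χ : ∀ {k b} → k ≤ 1 → (k ≡ 1 ⇔ b ≡ true) → k ≡ χ b
≤1⇒≡χ k≤1 k≡1⇔ =
  ≤-antisym (≤-χ k≤1 (λ k>0 → Equivalence.to k≡1⇔ (≤-antisym k≤1 k>0)))
            (χ-≤ (λ b≡true → ≤-reflexive (sym (Equivalence.from k≡1⇔ b≡true))))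

∣p∣≡∑χ : ∀ {n} (p : Subset n) → ∣ p ∣ ≡ ∑ (λ i → χ (lookup p i))
∣p∣≡∑χ []          = refl
∣p∣≡∑χ (true ∷ p)  = cong suc (∣p∣≡∑χ p)
∣p∣≡∑χ (false ∷ p) = ∣p∣≡∑χ p

lookup≡true⇔∈ : ∀ {n} {i : Fin n} {p : Subset n} → lookup p i ≡ true ⇔ i ∈ p
lookup≡true⇔∈ = mk⇔ (lookup⇒[]= _ _) []=⇒lookup

isYes≡true⇔ : ∀ {A : Set} (a? : Dec A) → isYes a? ≡ true ⇔ A
isYes≡true⇔ a? = mk⇔ (λ e → toWitness (Equivalence.from T-≡ e))
                     (λ a → Equivalence.to T-≡ (fromWitness a))

module _ (P N Z : ℕ) (zone : Fin N → Fin Z) (c : Fin N → ℕ)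
         (ρN ρZ s : ℕ) .{{_ : NonZero s}} where
  open Network P N Z zone c ρN ρZ s

  byZone : (Fin N → ℕ) → Fin Z → ℕ
  byZone g z = ∑ (λ n → if does (zone n ≟ z) then g n else 0)

  ∑-byZone : ∀ g → ∑ (byZone g) ≡ ∑ g
  ∑-byZone g = trans (sym (∑-comm (λ n z → if does (zone n ≟ z) then g n else 0)))
                     (∑-cong (λ n → ∑-indicator (zone n) (g n)))

  ≤-byZone : ∀ g {n z} → zone n ≡ z → g n ≤ byZone g z
  ≤-byZone g {n} {z} zn≡z = ≤-trans
    (≤-reflexive (cong (λ b → if b then g n else 0) (sym (dec-true (zone n ≟ z) zn≡z))))
    (f≤∑f (λ n → if does (zone n ≟ z) then g n else 0) n)

  byZone>0⇒∃ : ∀ g z → 0 < byZone g z → ∃ λ n → zone n ≡ z × 0 < g n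
  byZone>0⇒∃ g z ∑>0
    with ∑>0⇒∃>0 (λ n → if does (zone n ≟ z) then g n else 0) ∑>0
  ... | n , term>0 with zone n ≟ z
  ...   | yes zn≡z = n , zn≡z , term>0
  ...   | no  _    with () ← term>0

  ∈zonesOf⇔ : ∀ {A z} → z ∈ zonesOf A ⇔ ∃ λ n → n ∈ A × zone n ≡ z
  ∈zonesOf⇔ {A} {z} = ⇔.trans (⇔.sym lookup≡true⇔∈)
    (subst (λ b → b ≡ true ⇔ (∃ λ n → n ∈ A × zone n ≡ z))
           (sym (lookup∘tabulate _ z))
           (isYes≡true⇔ (any? (λ n → (n ∈? A) ×-dec (zone n ≟ z)))))

  inflow≤ρN : ρZ ≤ ρN → ∀ {f} → IsFlow f → ∀ p → f (s→p⁺ p) + f (s→p⁻ p) ≤ ρN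
  inflow≤ρN ρZ≤ρN F p =
    ≤-trans (+-mono-≤ (cap (s→p⁺ p)) (cap (s→p⁻ p))) (≤-reflexive (m+[n∸m]≡n ρZ≤ρN))
    where open IsFlow F

  value≤ρN*P : ρZ ≤ ρN → ∀ {f} → IsFlow f → value f ≤ ρN * P
  value≤ρN*P ρZ≤ρN F = ≤-trans (∑-mono-≤ (inflow≤ρN ρZ≤ρN F)) (≤-reflexive (∑-const ρN))

  value≡ρN*P⇒maximal : ρZ ≤ ρN → ∀ {f} → value f ≡ ρN * P →
                       ∀ g → IsFlow g → value g ≤ value f
  value≡ρN*P⇒maximal ρZ≤ρN value≡ g G =
    subst (value g ≤_) (sym value≡) (value≤ρN*P ρZ≤ρN G)

  value≡ρN*P⇒inflow≡ρN : ρZ ≤ ρN → ∀ {f} → IsFlow f → value f ≡ ρN * P →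
                          ∀ p → f (s→p⁺ p) + f (s→p⁻ p) ≡ ρN
  value≡ρN*P⇒inflow≡ρN ρZ≤ρN F value≡ =
    ∑-tight⇒≡ (inflow≤ρN ρZ≤ρN F) (≤-reflexive (trans (∑-const ρN) (sym value≡)))

  ∑x→n≡inflow : ∀ {f} → IsFlow f → ∀ p →
                ∑ (λ n → f (x→n p n)) ≡ f (s→p⁺ p) + f (s→p⁻ p)
  ∑x→n≡inflow {f} F p = begin
    ∑ (λ n → f (x→n p n))                 ≡⟨ sym (∑-byZone (λ n → f (x→n p n))) ⟩
    ∑ (byZone (λ n → f (x→n p n)))        ≡⟨ ∑-cong (λ z → sym (cons-x p z)) ⟩
    ∑ (λ z → f (p⁺→x p z) + f (p⁻→x p z)) ≡⟨ ∑-distrib-+ (λ z → f (p⁺→x p z)) _ ⟩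
    ∑ (λ z → f (p⁺→x p z)) + ∑ (λ z → f (p⁻→x p z))
                                          ≡⟨ sym (cong₂ _+_ (cons-p⁺ p) (cons-p⁻ p)) ⟩
    f (s→p⁺ p) + f (s→p⁻ p)               ∎
    where open IsFlow F
          open ≡-Reasoning

  module _ (α : Assignment) where

    replicas : Fin P → Fin N → ℕ
    replicas p n = χ (lookup (α p) n)

    replicasIn : Fin P → Fin Z → ℕ
    replicasIn p = byZone (replicas p)

    zoneHit : Fin P → Fin Z → ℕ
    zoneHit p z = χ (lookup (zonesOf (α p)) z)

    ∣partitionsOn∣≡∑replicas : ∀ n → ∣ partitionsOn α n ∣ ≡ ∑ (λ p → replicas p n)
    ∣partitionsOn∣≡∑replicas n = trans (∣p∣≡∑χ (partitionsOn α n)) (∑-cong λ p → cong χ (begin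
      lookup (partitionsOn α n) p  ≡⟨ lookup∘tabulate _ p ⟩
      isYes (n ∈? α p)             ≡⟨ ⇔→≡ (⇔.trans (isYes≡true⇔ (n ∈? α p))
                                                   (⇔.sym lookup≡true⇔∈)) ⟩
      lookup (α p) n               ∎))
      where open ≡-Reasoning

    zoneHit≤replicasIn : ∀ p z → zoneHit p z ≤ replicasIn p z
    zoneHit≤replicasIn p z = χ-≤ λ hit →
      let n , n∈αp , zn≡z = Equivalence.to ∈zonesOf⇔ (Equivalence.to lookup≡true⇔∈ hit)
      in ≤-trans (≤-reflexive (cong χ (sym ([]=⇒lookup n∈αp))))
                 (≤-byZone (replicas p) zn≡z)

    Encodes : (Arc → ℕ) → Set
    Encodes f = ∀ p n → f (x→n p n) ≡ 1 ⇔ n ∈ α p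

    realizable⇒flow : ρZ ≤ ρN → Realizable α →
                      Σ (Arc → ℕ) λ f → IsMaxFlow f × value f ≡ ρN * P × Encodes f
    realizable⇒flow ρZ≤ρN R =
      flow , (isFlow , value≡ρN*P⇒maximal ρZ≤ρN {flow} value≡) , value≡ ,
      λ p n → ⇔.trans χ≡1⇔ lookup≡true⇔∈
      where
      open Realizable R

      -- Through p⁺, one unit to each of ρZ distinct zones met by α p;
      -- through p⁻, the remaining replicas of p zone by zone.
      chosen : ∀ p → Σ (Fin Z → ℕ) λ g → (∀ z → g z ≤ zoneHit p z) × ∑ g ≡ ρZ
      chosen p = ∑-truncate (zoneHit p) ρZ (subst (ρZ ≤_) (∣p∣≡∑χ (zonesOf (α p))) (scatter p))

      primary : Fin P → Fin Z → ℕ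
      primary p = proj₁ (chosen p)

      secondary : Fin P → Fin Z → ℕ
      secondary p z = replicasIn p z ∸ primary p z

      primary≤replicasIn : ∀ p z → primary p z ≤ replicasIn p z
      primary≤replicasIn p z = ≤-trans (proj₁ (proj₂ (chosen p)) z) (zoneHit≤replicasIn p z)

      ∑secondary : ∀ p → ∑ (secondary p) ≡ ρN ∸ ρZ
      ∑secondary p = begin
        ∑ (secondary p)                        ≡⟨ ∑-distrib-∸ _ _ (primary≤replicasIn p) ⟩
        ∑ (replicasIn p) ∸ ∑ (primary p)       ≡⟨ cong₂ _∸_ (∑-byZone (replicas p))
                                                            (proj₂ (proj₂ (chosen p))) ⟩
        ∑ (replicas p) ∸ ρZ                    ≡⟨ cong (_∸ ρZ) (trans (sym (∣p∣≡∑χ (α p)))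
                                                                      (size p)) ⟩
        ρN ∸ ρZ                                ∎
        where open ≡-Reasoning

      flow : Arc → ℕ
      flow (s→p⁺ p)   = ρZ
      flow (s→p⁻ p)   = ρN ∸ ρZ
      flow (p⁺→x p z) = primary p z
      flow (p⁻→x p z) = secondary p z
      flow (x→n p n)  = replicas p n
      flow (n→t n)    = ∑ (λ p → replicas p n)

      within-capacity : ∀ e → flow e ≤ capacity e
      within-capacity (s→p⁺ p)   = ≤-refl
      within-capacity (s→p⁻ p)   = ≤-refl
      within-capacity (p⁺→x p z) = ≤-trans (proj₁ (proj₂ (chosen p)) z) (χ≤1 _)
      within-capacity (p⁻→x p z) = ≤-trans (f≤∑f (secondary p) z) (≤-reflexive (∑secondary p))
      within-capacity (x→n p n)  = χ≤1 _
      within-capacity (n→t n)    = Equivalence.to (*≤⇔≤/ _ s (c n))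
        (subst (λ k → s * k ≤ c n) (∣partitionsOn∣≡∑replicas n) (load n))

      isFlow : IsFlow flow
      isFlow = record
        { cap     = within-capacity
        ; cons-p⁺ = λ p → sym (proj₂ (proj₂ (chosen p)))
        ; cons-p⁻ = λ p → sym (∑secondary p)
        ; cons-x  = λ p z → m+[n∸m]≡n (primary≤replicasIn p z)
        ; cons-n  = λ n → refl
        }

      value≡ : value flow ≡ ρN * P
      value≡ = trans (∑-cong {P} (λ _ → m+[n∸m]≡n ρZ≤ρN)) (∑-const ρN)

    flow⇒realizable : ρZ ≤ ρN → ∀ {f} → IsFlow f → value f ≡ ρN * P → Encodes f →
                      Realizable α
    flow⇒realizable ρZ≤ρN {f} F value≡ encodes =
      record { size = size ; scatter = scatter ; load = load }
      where
      open IsFlow F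

      carries : ∀ p n → f (x→n p n) ≡ replicas p n
      carries p n = ≤1⇒≡χ (cap (x→n p n)) (⇔.trans (encodes p n) (⇔.sym lookup≡true⇔∈))

      inflow≡ρN : ∀ p → f (s→p⁺ p) + f (s→p⁻ p) ≡ ρN
      inflow≡ρN = value≡ρN*P⇒inflow≡ρN ρZ≤ρN F value≡

      size : ∀ p → ∣ α p ∣ ≡ ρN
      size p = begin
        ∣ α p ∣                  ≡⟨ ∣p∣≡∑χ (α p) ⟩
        ∑ (replicas p)           ≡⟨ ∑-cong (λ n → sym (carries p n)) ⟩
        ∑ (λ n → f (x→n p n))    ≡⟨ ∑x→n≡inflow F p ⟩
        f (s→p⁺ p) + f (s→p⁻ p)  ≡⟨ inflow≡ρN p ⟩
        ρN                       ∎
        where open ≡-Reasoning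

      ρZ≤f⁺ : ∀ p → ρZ ≤ f (s→p⁺ p)
      ρZ≤f⁺ p = +-cancelʳ-≤ (ρN ∸ ρZ) ρZ (f (s→p⁺ p)) (begin
        ρZ + (ρN ∸ ρZ)           ≡⟨ m+[n∸m]≡n ρZ≤ρN ⟩
        ρN                       ≡⟨ inflow≡ρN p ⟨
        f (s→p⁺ p) + f (s→p⁻ p)  ≤⟨ +-monoʳ-≤ (f (s→p⁺ p)) (cap (s→p⁻ p)) ⟩
        f (s→p⁺ p) + (ρN ∸ ρZ)   ∎)
        where open ≤-Reasoning

      p⁺→x≤zoneHit : ∀ p z → f (p⁺→x p z) ≤ zoneHit p z
      p⁺→x≤zoneHit p z = ≤-χ (cap (p⁺→x p z)) λ f>0 →
        let n , zn≡z , fx>0 = byZone>0⇒∃ (λ n → f (x→n p n)) z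
                                (subst (0 <_) (cons-x p z) (≤-trans f>0 (m≤m+n _ _)))
            n∈αp = Equivalence.to lookup≡true⇔∈ (χ>0⇒≡true (subst (0 <_) (carries p n) fx>0))
        in Equivalence.from lookup≡true⇔∈ (Equivalence.from ∈zonesOf⇔ (n , n∈αp , zn≡z))

      scatter : ∀ p → ρZ ≤ ∣ zonesOf (α p) ∣
      scatter p = begin
        ρZ                         ≤⟨ ρZ≤f⁺ p ⟩
        f (s→p⁺ p)                 ≡⟨ cons-p⁺ p ⟩
        ∑ (λ z → f (p⁺→x p z))     ≤⟨ ∑-mono-≤ (p⁺→x≤zoneHit p) ⟩
        ∑ (zoneHit p)              ≡⟨ ∣p∣≡∑χ (zonesOf (α p)) ⟨
        ∣ zonesOf (α p) ∣          ∎
        where open ≤-Reasoning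

      load : ∀ n → s * ∣ partitionsOn α n ∣ ≤ c n
      load n = Equivalence.from (*≤⇔≤/ _ s (c n)) (begin
        ∣ partitionsOn α n ∣       ≡⟨ ∣partitionsOn∣≡∑replicas n ⟩
        ∑ (λ p → replicas p n)     ≡⟨ ∑-cong (λ p → sym (carries p n)) ⟩
        ∑ (λ p → f (x→n p n))      ≡⟨ cons-n n ⟩
        f (n→t n)                  ≤⟨ cap (n→t n) ⟩
        c n / s                    ∎)
        where open ≤-Reasoning

proposition1 : (P N Z : ℕ) (zone : Fin N → Fin Z) (c : Fin N → ℕ)
    (ρN ρZ s : ℕ) .{{_ : NonZero s}} → 1 ≤ ρZ → ρZ ≤ ρN →
    (α : Network.Assignment P N Z zone c ρN ρZ s) →
    Network.Realizable P N Z zone c ρN ρZ s α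
      ⇔ Σ (Network.Arc P N Z zone c ρN ρZ s → ℕ) (λ f →
          Network.IsMaxFlow P N Z zone c ρN ρZ s f
          × Network.value P N Z zone c ρN ρZ s f ≡ ρN * P
          × (∀ p n → (f (Network.x→n p n) ≡ 1 ⇔ n ∈ α p)))
proposition1 P N Z zone c ρN ρZ s _ ρZ≤ρN α = mk⇔
  (realizable⇒flow P N Z zone c ρN ρZ s α ρZ≤ρN)
  (λ (f , (F , _) , value≡ , encodes) →
     flow⇒realizable P N Z zone c ρN ρZ s α ρZ≤ρN F value≡ encodes)
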